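{- The calculus $\mathsf{IEL}^{ - }$ is decidable: there is an algorithm which, given a formula $A$, decides whether $\mathsf{IEL}^{ - }\vdash A$.
   Context: Formulas: built from propositional atoms and $\bot$ by $\wedge,\vee,\rightarrow$ and a unary modality $\Box$. $\mathsf{IEL}^{ - }$ is the natural deduction system with the usual intuitionistic (NJ) introduction/elimination rules for $\wedge,\vee,\rightarrow$, ex falso ($\bot$-elimination), and the $\Box$-intro rule: from deductions of $\Box A_1,\dots,\Box A_n$ (from assumptions $\Gamma_1,\dots,\Gamma_n$) and a deduction of $B$ from assumptions $A_1,\dots,A_n,\Delta$, infer $\Box B$, discharging $A_1,\dots,A_n$ ($n\ge0$). $\mathsf{IEL}^{ - }\vdash A$ means $A$ has a deduction with no undischarged assumptions. (It is equivalent to the Hilbert system: intuitionistic propositional axioms, $\Box(A\rightarrow B)\rightarrow\Box A\rightarrow\Box B$, $A\rightarrow\Box A$, modus ponens.) -}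

module Defs where

open import Data.Nat using (ℕ)
open import Data.List using (List; []; _∷_; _++_)
open import Data.List.Membership.Propositional using (_∈_)
open import Data.List.Relation.Unary.All using (All)

infixr 6 _∧_
infixr 5 _∨_
infixr 4 _⇒_

data Formula : Set where
  atom : ℕ → Formula
  ⊥'   : Formula
  _∧_  : Formula → Formula → Formula
  _∨_  : Formula → Formula → Formula
  _⇒_  : Formula → Formula → Formula
  □_   : Formula → Formula

Context : Set
Context = List Formula

infix 2 _⊢_

data _⊢_ (Γ : Context) : Formula → Set where
  ax    : ∀ {A} → A ∈ Γ → Γ ⊢ A
  ∧I    : ∀ {A B} → Γ ⊢ A → Γ ⊢ B → Γ ⊢ A ∧ B
  ∧E₁   : ∀ {A B} → Γ ⊢ A ∧ B → Γ ⊢ A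
  ∧E₂   : ∀ {A B} → Γ ⊢ A ∧ B → Γ ⊢ B
  ∨I₁   : ∀ {A B} → Γ ⊢ A → Γ ⊢ A ∨ B
  ∨I₂   : ∀ {A B} → Γ ⊢ B → Γ ⊢ A ∨ B
  ∨E    : ∀ {A B C} → Γ ⊢ A ∨ B → A ∷ Γ ⊢ C → B ∷ Γ ⊢ C → Γ ⊢ C
  ⇒I    : ∀ {A B} → A ∷ Γ ⊢ B → Γ ⊢ A ⇒ B
  ⇒E    : ∀ {A B} → Γ ⊢ A ⇒ B → Γ ⊢ A → Γ ⊢ B
  ⊥E    : ∀ {A} → Γ ⊢ ⊥' → Γ ⊢ A
  □I    : ∀ {B} (As : List Formula) → All (λ A → Γ ⊢ □ A) As → As ++ Γ ⊢ B → Γ ⊢ □ B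

IEL⁻⊢ : Formula → Set
IEL⁻⊢ A = [] ⊢ A

-- Let S be the finite, subformula-closed set of subformulas of A. Derivability Γ ⊢ˢ C in a
-- G3-style sequent calculus whose contexts are subsets of S is the least fixed point of a
-- monotone rule operator on the finitely many sequents over S; iterating the operator
-- stabilises after at most as many steps as there are such sequents, so ⊢ˢ is decidable.
-- It is sound for natural deduction. Conversely, a sequent Γ ⊢ˢ C that is not derivable
-- extends to a saturated context that still does not derive C, and the saturated contexts
-- form a Kripke model of IEL⁻ in which every member of a world is forced and every forced
-- formula is derivable; soundness of natural deduction for Kripke models then gives
-- completeness.
module Submission where

open import Defs
open import Data.Bool.Properties using (T-≡)
open import Data.Empty using (⊥; ⊥-elim)
open import Data.Fin using (Fin)
open import Data.Fin.Subset
  using (Subset; inside; outside; _∪_; _⊂_; _⊃_)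
  renaming (_∈_ to _∈ˢ_; _⊆_ to _⊆ˢ_; ⊥ to ∅)
open import Data.Fin.Subset.Properties
  using (x∈p∪q⁻; p⊆p∪q; q⊆p∪q; ∉⊥; p⊂q⇒p⊆q)
  renaming (_∈?_ to _∈ˢ?_; ⊆-trans to ⊆ˢ-trans; ⊆-refl to ⊆ˢ-refl)
open import Data.Fin.Subset.Induction using (⊃-wellFounded; Acc; acc)
open import Data.List
  using (List; []; _∷_; _++_; [_]; length; map; filter; lookup; allFin;
         cartesianProduct; cartesianProductWith)
open import Data.List.Membership.Propositional using (_∈_; _∉_; find; lose)
open import Data.List.Membership.Propositional.Properties
  using (∈-++⁺ˡ; ∈-++⁺ʳ; ∈-++⁻; ∈-map⁺; ∈-map⁻; ∈-filter⁺; ∈-filter⁻; ∈-allFin;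
         ∈-lookup;
         ∈-cartesianProduct⁺; ∈-cartesianProduct⁻; ∈-cartesianProductWith⁺)
open import Data.List.Properties using (length-filter)
open import Data.List.Relation.Binary.Subset.Propositional using (_⊆_)
open import Data.List.Relation.Binary.Subset.Propositional.Properties
  using (∷⁺ʳ; ++⁺ʳ; xs⊆xs++ys; xs⊆ys++xs)
open import Data.List.Relation.Unary.All as All using (All; []; _∷_; all?)
open import Data.List.Relation.Unary.All.Properties.Core using (¬All⇒Any¬)
open import Data.List.Relation.Unary.All.Properties using (++⁺)
open import Data.List.Relation.Unary.Any using (Any; here; there; any?; index)
open import Data.List.Relation.Unary.Any.Properties using (lookup-index)
open import Data.Nat using (ℕ; zero; suc; _≤_; _<_; z≤n; s≤s)
import Data.Nat.Properties as ℕ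
open import Data.Product as Product using (∃-syntax; _×_; _,_; proj₁; proj₂; uncurry)
open import Data.Sum as Sum using (_⊎_; inj₁; inj₂)
open import Data.Unit using (⊤; tt)
open import Data.Vec using ([]; _∷_; tabulate)
open import Data.Vec.Properties using (lookup∘tabulate; lookup⇒[]=; []=⇒lookup)
open import Function using (_∘_; id; const; Equivalence)
open import Level using (0ℓ)
open import Relation.Binary.Definitions using (DecidableEquality)
open import Relation.Binary.PropositionalEquality using (_≡_; refl; sym; trans; cong; cong₂; subst)
open import Relation.Nullary using (Dec; yes; no; ¬_; contradiction)
open import Relation.Nullary.Decidable
  using (map′; _×-dec_; _⊎-dec_; _→-dec_; ¬?; isYes; toWitness; fromWitness; decidable-stable)
open import Relation.Unary using (Pred; Decidable)

private
  variable
    A B C F G : Formula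

infix 4 _≟_
_≟_ : DecidableEquality Formula
atom p  ≟ atom q  = map′ (cong atom) (λ { refl → refl }) (p ℕ.≟ q)
⊥'      ≟ ⊥'      = yes refl
(A ∧ B) ≟ (C ∧ D) = map′ (uncurry (cong₂ _∧_)) (λ { refl → refl , refl }) (A ≟ C ×-dec B ≟ D)
(A ∨ B) ≟ (C ∨ D) = map′ (uncurry (cong₂ _∨_)) (λ { refl → refl , refl }) (A ≟ C ×-dec B ≟ D)
(A ⇒ B) ≟ (C ⇒ D) = map′ (uncurry (cong₂ _⇒_)) (λ { refl → refl , refl }) (A ≟ C ×-dec B ≟ D)
□ A     ≟ □ B     = map′ (cong □_) (λ { refl → refl }) (A ≟ B)
atom _  ≟ ⊥'      = no λ ()
atom _  ≟ (_ ∧ _) = no λ ()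
atom _  ≟ (_ ∨ _) = no λ ()
atom _  ≟ (_ ⇒ _) = no λ ()
atom _  ≟ □ _     = no λ ()
⊥'      ≟ atom _  = no λ ()
⊥'      ≟ (_ ∧ _) = no λ ()
⊥'      ≟ (_ ∨ _) = no λ ()
⊥'      ≟ (_ ⇒ _) = no λ ()
⊥'      ≟ □ _     = no λ ()
(_ ∧ _) ≟ atom _  = no λ ()
(_ ∧ _) ≟ ⊥'      = no λ ()
(_ ∧ _) ≟ (_ ∨ _) = no λ ()
(_ ∧ _) ≟ (_ ⇒ _) = no λ ()
(_ ∧ _) ≟ □ _     = no λ ()
(_ ∨ _) ≟ atom _  = no λ ()
(_ ∨ _) ≟ ⊥'      = no λ ()
(_ ∨ _) ≟ (_ ∧ _) = no λ ()
(_ ∨ _) ≟ (_ ⇒ _) = no λ ()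
(_ ∨ _) ≟ □ _     = no λ ()
(_ ⇒ _) ≟ atom _  = no λ ()
(_ ⇒ _) ≟ ⊥'      = no λ ()
(_ ⇒ _) ≟ (_ ∧ _) = no λ ()
(_ ⇒ _) ≟ (_ ∨ _) = no λ ()
(_ ⇒ _) ≟ □ _     = no λ ()
□ _     ≟ atom _  = no λ ()
□ _     ≟ ⊥'      = no λ ()
□ _     ≟ (_ ∧ _) = no λ ()
□ _     ≟ (_ ∨ _) = no λ ()
□ _     ≟ (_ ⇒ _) = no λ ()

open import Data.List.Membership.DecPropositional _≟_ using (_∈?_)

infix 3 _◁_
data _◁_ : Formula → Formula → Set where
  ∧◁ˡ : A ◁ A ∧ B
  ∧◁ʳ : B ◁ A ∧ B
  ∨◁ˡ : A ◁ A ∨ B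
  ∨◁ʳ : B ◁ A ∨ B
  ⇒◁ˡ : A ◁ A ⇒ B
  ⇒◁ʳ : B ◁ A ⇒ B
  □◁  : A ◁ □ A

SubformulaClosed : List Formula → Set
SubformulaClosed S = ∀ {A B} → A ◁ B → B ∈ S → A ∈ S

mutual
  subformulas : Formula → List Formula
  subformulas F = F ∷ properSubformulas F

  properSubformulas : Formula → List Formula
  properSubformulas (A ∧ B) = subformulas A ++ subformulas B
  properSubformulas (A ∨ B) = subformulas A ++ subformulas B
  properSubformulas (A ⇒ B) = subformulas A ++ subformulas B
  properSubformulas (□ A)   = subformulas A
  properSubformulas _       = []

mutual
  subformulas-⊆ : F ∈ subformulas G → subformulas F ⊆ subformulas G
  subformulas-⊆ (here refl) = id
  subformulas-⊆ {G = G} (there F∈G) = there ∘ properSubformulas-⊆ G F∈G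

  properSubformulas-⊆ : ∀ G → F ∈ properSubformulas G → subformulas F ⊆ properSubformulas G
  properSubformulas-⊆ (A ∧ B) = ++-⊆ A B
  properSubformulas-⊆ (A ∨ B) = ++-⊆ A B
  properSubformulas-⊆ (A ⇒ B) = ++-⊆ A B
  properSubformulas-⊆ (□ A)   = subformulas-⊆

  ++-⊆ : ∀ A B → F ∈ subformulas A ++ subformulas B → subformulas F ⊆ subformulas A ++ subformulas B
  ++-⊆ A B F∈ with ∈-++⁻ (subformulas A) F∈
  ... | inj₁ F∈A = ∈-++⁺ˡ ∘ subformulas-⊆ F∈A
  ... | inj₂ F∈B = ∈-++⁺ʳ (subformulas A) ∘ subformulas-⊆ F∈B

◁⇒∈properSubformulas : A ◁ B → A ∈ properSubformulas B
◁⇒∈properSubformulas (∧◁ˡ {B = B}) = xs⊆xs++ys _ (subformulas B) (here refl)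
◁⇒∈properSubformulas (∧◁ʳ {A = A}) = xs⊆ys++xs _ (subformulas A) (here refl)
◁⇒∈properSubformulas (∨◁ˡ {B = B}) = xs⊆xs++ys _ (subformulas B) (here refl)
◁⇒∈properSubformulas (∨◁ʳ {A = A}) = xs⊆ys++xs _ (subformulas A) (here refl)
◁⇒∈properSubformulas (⇒◁ˡ {B = B}) = xs⊆xs++ys _ (subformulas B) (here refl)
◁⇒∈properSubformulas (⇒◁ʳ {A = A}) = xs⊆ys++xs _ (subformulas A) (here refl)
◁⇒∈properSubformulas □◁            = here refl

subformulas-closed : ∀ F → SubformulaClosed (subformulas F)
subformulas-closed F A◁B B∈F = subformulas-⊆ B∈F (there (◁⇒∈properSubformulas A◁B))

mutual
  weaken : ∀ {Γ Δ} → Γ ⊆ Δ → Γ ⊢ A → Δ ⊢ A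
  weaken Γ⊆Δ (ax A∈Γ)     = ax (Γ⊆Δ A∈Γ)
  weaken Γ⊆Δ (∧I d e)     = ∧I (weaken Γ⊆Δ d) (weaken Γ⊆Δ e)
  weaken Γ⊆Δ (∧E₁ d)      = ∧E₁ (weaken Γ⊆Δ d)
  weaken Γ⊆Δ (∧E₂ d)      = ∧E₂ (weaken Γ⊆Δ d)
  weaken Γ⊆Δ (∨I₁ d)      = ∨I₁ (weaken Γ⊆Δ d)
  weaken Γ⊆Δ (∨I₂ d)      = ∨I₂ (weaken Γ⊆Δ d)
  weaken Γ⊆Δ (∨E d e f)   = ∨E (weaken Γ⊆Δ d) (weaken (∷⁺ʳ _ Γ⊆Δ) e) (weaken (∷⁺ʳ _ Γ⊆Δ) f)
  weaken Γ⊆Δ (⇒I d)       = ⇒I (weaken (∷⁺ʳ _ Γ⊆Δ) d)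
  weaken Γ⊆Δ (⇒E d e)     = ⇒E (weaken Γ⊆Δ d) (weaken Γ⊆Δ e)
  weaken Γ⊆Δ (⊥E d)       = ⊥E (weaken Γ⊆Δ d)
  weaken Γ⊆Δ (□I As ds d) = □I As (weaken-□ Γ⊆Δ ds) (weaken (++⁺ʳ As Γ⊆Δ) d)

  weaken-□ : ∀ {Γ Δ As} → Γ ⊆ Δ → All (λ A → Γ ⊢ □ A) As → All (λ A → Δ ⊢ □ A) As
  weaken-□ Γ⊆Δ []       = []
  weaken-□ Γ⊆Δ (d ∷ ds) = weaken Γ⊆Δ d ∷ weaken-□ Γ⊆Δ ds

cut : ∀ {Γ} → Γ ⊢ A → A ∷ Γ ⊢ C → Γ ⊢ C
cut a d = ⇒E (⇒I d) a

record Model : Set₁ where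
  field
    W      : Set
    _≼_    : W → W → Set
    E      : W → W → Set
    V      : W → ℕ → Set
    ≼-refl  : ∀ {w} → w ≼ w
    ≼-trans : ∀ {u v w} → u ≼ v → v ≼ w → u ≼ w
    E⇒≼    : ∀ {u v} → E u v → u ≼ v
    ≼-E    : ∀ {u v w} → u ≼ v → E v w → E u w
    V-mono : ∀ {u v p} → u ≼ v → V u p → V v p

module Forcing (M : Model) where
  open Model M

  infix 3 _⊩_
  _⊩_ : W → Formula → Set
  w ⊩ atom p = V w p
  w ⊩ ⊥'     = ⊥
  w ⊩ A ∧ B  = w ⊩ A × w ⊩ B
  w ⊩ A ∨ B  = w ⊩ A ⊎ w ⊩ B
  w ⊩ A ⇒ B  = ∀ v → w ≼ v → v ⊩ A → v ⊩ B
  w ⊩ □ A    = ∀ v → E w v → v ⊩ A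

  ⊩-mono : ∀ A {w v} → w ≼ v → w ⊩ A → v ⊩ A
  ⊩-mono (atom p) w≼v a        = V-mono w≼v a
  ⊩-mono (A ∧ B)  w≼v (a , b)  = ⊩-mono A w≼v a , ⊩-mono B w≼v b
  ⊩-mono (A ∨ B)  w≼v (inj₁ a) = inj₁ (⊩-mono A w≼v a)
  ⊩-mono (A ∨ B)  w≼v (inj₂ b) = inj₂ (⊩-mono B w≼v b)
  ⊩-mono (A ⇒ B)  w≼v f        = λ u v≼u → f u (≼-trans w≼v v≼u)
  ⊩-mono (□ A)    w≼v f        = λ u vEu → f u (≼-E w≼v vEu)

  ⊩*-mono : ∀ {Γ w v} → w ≼ v → All (w ⊩_) Γ → All (v ⊩_) Γ
  ⊩*-mono {[]}    w≼v []      = []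
  ⊩*-mono {A ∷ Γ} w≼v (a ∷ ρ) = ⊩-mono A w≼v a ∷ ⊩*-mono w≼v ρ

  mutual
    ⊩-sound : ∀ {Γ w} → Γ ⊢ A → All (w ⊩_) Γ → w ⊩ A
    ⊩-sound (ax A∈Γ)   ρ = All.lookup ρ A∈Γ
    ⊩-sound (∧I d e)   ρ = ⊩-sound d ρ , ⊩-sound e ρ
    ⊩-sound (∧E₁ d)    ρ = proj₁ (⊩-sound d ρ)
    ⊩-sound (∧E₂ d)    ρ = proj₂ (⊩-sound d ρ)
    ⊩-sound (∨I₁ d)    ρ = inj₁ (⊩-sound d ρ)
    ⊩-sound (∨I₂ d)    ρ = inj₂ (⊩-sound d ρ)
    ⊩-sound (∨E d e f) ρ with ⊩-sound d ρ
    ... | inj₁ a = ⊩-sound e (a ∷ ρ)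
    ... | inj₂ b = ⊩-sound f (b ∷ ρ)
    ⊩-sound (⇒I d)     ρ = λ v w≼v a → ⊩-sound d (a ∷ ⊩*-mono w≼v ρ)
    ⊩-sound (⇒E d e)   ρ = ⊩-sound d ρ _ ≼-refl (⊩-sound e ρ)
    ⊩-sound (⊥E d)     ρ = ⊥-elim (⊩-sound d ρ)
    ⊩-sound (□I As ds d) ρ = λ v wEv → ⊩-sound d (++⁺ (⊩-sound-□ ds ρ v wEv) (⊩*-mono (E⇒≼ wEv) ρ))

    ⊩-sound-□ : ∀ {Γ w As} → All (λ A → Γ ⊢ □ A) As → All (w ⊩_) Γ → ∀ v → E w v → All (v ⊩_) As
    ⊩-sound-□ []       ρ v wEv = []
    ⊩-sound-□ (d ∷ ds) ρ v wEv = ⊩-sound d ρ v wEv ∷ ⊩-sound-□ ds ρ v wEv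

count : {X : Set} {P : Pred X 0ℓ} → Decidable P → List X → ℕ
count P? = length ∘ filter P?

module _ {X : Set} {P Q : Pred X 0ℓ} (P? : Decidable P) (Q? : Decidable Q) where

  count-≤ : ∀ {xs} → (∀ {x} → x ∈ xs → P x → Q x) → count P? xs ≤ count Q? xs
  count-≤ {[]}     P⊆Q = z≤n
  count-≤ {x ∷ xs} P⊆Q with P? x | Q? x
  ... | yes _ | yes _  = s≤s (count-≤ (P⊆Q ∘ there))
  ... | yes p | no ¬q  = contradiction (P⊆Q (here refl) p) ¬q
  ... | no _  | yes _  = ℕ.m≤n⇒m≤1+n (count-≤ (P⊆Q ∘ there))
  ... | no _  | no _   = count-≤ (P⊆Q ∘ there)

  count-< : ∀ {xs} → (∀ {x} → x ∈ xs → P x → Q x) → Any (λ x → Q x × ¬ P x) xs →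
            count P? xs < count Q? xs
  count-< {x ∷ xs} P⊆Q (here (q , ¬p)) with P? x | Q? x
  ... | yes p | _      = contradiction p ¬p
  ... | no _  | yes _  = s≤s (count-≤ (P⊆Q ∘ there))
  ... | no _  | no ¬q  = contradiction q ¬q
  count-< {x ∷ xs} P⊆Q (there new) with P? x | Q? x
  ... | yes _ | yes _  = s≤s (count-< (P⊆Q ∘ there) new)
  ... | yes p | no ¬q  = contradiction (P⊆Q (here refl) p) ¬q
  ... | no _  | yes _  = ℕ.m≤n⇒m≤1+n (count-< (P⊆Q ∘ there) new)
  ... | no _  | no _   = count-< (P⊆Q ∘ there) new

module LeastFixedPoint
  {X : Set} (U : List X) (F : Pred X 0ℓ → Pred X 0ℓ)
  (F-mono : ∀ {P Q} → (∀ {x} → x ∈ U → P x → Q x) → ∀ {x} → x ∈ U → F P x → F Q x)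
  (F? : ∀ {P} → Decidable P → Decidable (F P))
  where

  iterate : ℕ → Pred X 0ℓ
  iterate zero    _ = ⊥
  iterate (suc k)   = F (iterate k)

  iterate? : ∀ k → Decidable (iterate k)
  iterate? zero    _ = no λ ()
  iterate? (suc k)   = F? (iterate? k)

  iterate-suc : ∀ k {x} → x ∈ U → iterate k x → iterate (suc k) x
  iterate-suc zero    _ ()
  iterate-suc (suc k) = F-mono (iterate-suc k)

  Stable : ℕ → Set
  Stable k = ∀ {x} → x ∈ U → iterate (suc k) x → iterate k x

  stable-or-large : ∀ k → Stable k ⊎ k ≤ count (iterate? k) U
  stable-or-large zero = inj₂ z≤n
  stable-or-large (suc k) with stable-or-large k
  ... | inj₁ stable = inj₁ (F-mono stable)
  ... | inj₂ large with any? (λ x → iterate? (suc k) x ×-dec ¬? (iterate? k x)) U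
  ...   | yes new  = inj₂ (ℕ.≤-trans (s≤s large)
                                 (count-< (iterate? k) (iterate? (suc k)) (iterate-suc k) new))
  ...   | no ¬new  = inj₁ (F-mono λ {x} x∈U next →
                       decidable-stable (iterate? k x) λ ¬now → ¬new (lose x∈U (next , ¬now)))

  μ : Pred X 0ℓ
  μ = iterate (suc (length U))

  μ? : Decidable μ
  μ? = iterate? (suc (length U))

  μ-closed : ∀ {x} → x ∈ U → F μ x → μ x
  μ-closed with stable-or-large (suc (length U))
  ... | inj₁ stable = stable
  ... | inj₂ large  = ⊥-elim (ℕ.1+n≰n (ℕ.≤-trans large (length-filter (iterate? (suc (length U))) U)))

  μ-least : ∀ {P} → (∀ {x} → x ∈ U → F P x → P x) → ∀ {x} → x ∈ U → μ x → P x
  μ-least {P} F-closed = iterate⊆ (suc (length U))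
    where
      iterate⊆ : ∀ k {x} → x ∈ U → iterate k x → P x
      iterate⊆ zero    _   ()
      iterate⊆ (suc k) x∈U = F-closed x∈U ∘ F-mono (iterate⊆ k) x∈U

subsets : ∀ n → List (Subset n)
subsets zero    = [ [] ]
subsets (suc n) = cartesianProductWith _∷_ (inside ∷ outside ∷ []) (subsets n)

∈-subsets : ∀ {n} (p : Subset n) → p ∈ subsets n
∈-subsets []            = here refl
∈-subsets (inside ∷ p)  =
  ∈-cartesianProductWith⁺ _∷_ {xs = inside ∷ outside ∷ []} (here refl) (∈-subsets p)
∈-subsets (outside ∷ p) =
  ∈-cartesianProductWith⁺ _∷_ {xs = inside ∷ outside ∷ []} (there (here refl)) (∈-subsets p)

module FiniteContexts (S : List Formula) where

  Ctx : Set
  Ctx = Subset (length S)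

  private
    variable
      Γ Δ : Ctx
      i : Fin (length S)

  ⟦_⟧ : Ctx → List Formula
  ⟦ Γ ⟧ = map (lookup S) (filter (_∈ˢ? Γ) (allFin _))

  ∈⟦⟧⁺ : i ∈ˢ Γ → F ≡ lookup S i → F ∈ ⟦ Γ ⟧
  ∈⟦⟧⁺ {i} i∈Γ refl = ∈-map⁺ (lookup S) (∈-filter⁺ (_∈ˢ? _) (∈-allFin i) i∈Γ)

  ∈⟦⟧⁻ : F ∈ ⟦ Γ ⟧ → ∃[ i ] i ∈ˢ Γ × F ≡ lookup S i
  ∈⟦⟧⁻ F∈Γ with ∈-map⁻ (lookup S) F∈Γ
  ... | i , i∈ , F≡ = i , proj₂ (∈-filter⁻ (_∈ˢ? _) {xs = allFin _} i∈) , F≡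

  ⟦⟧⊆S : ⟦ Γ ⟧ ⊆ S
  ⟦⟧⊆S F∈Γ with ∈⟦⟧⁻ F∈Γ
  ... | i , _ , refl = ∈-lookup i

  ⟦⟧-mono : Γ ⊆ˢ Δ → ⟦ Γ ⟧ ⊆ ⟦ Δ ⟧
  ⟦⟧-mono Γ⊆Δ F∈Γ with ∈⟦⟧⁻ F∈Γ
  ... | i , i∈Γ , F≡ = ∈⟦⟧⁺ (Γ⊆Δ i∈Γ) F≡

  ⟦∅⟧⊆[] : ⟦ ∅ ⟧ ⊆ []
  ⟦∅⟧⊆[] F∈∅ = ⊥-elim (∉⊥ (proj₁ (proj₂ (∈⟦⟧⁻ F∈∅))))

  ⊆-new⇒⊂ : Γ ⊆ˢ Δ → F ∈ ⟦ Δ ⟧ → F ∉ ⟦ Γ ⟧ → Γ ⊂ Δ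
  ⊆-new⇒⊂ Γ⊆Δ F∈Δ F∉Γ with ∈⟦⟧⁻ F∈Δ
  ... | i , i∈Δ , F≡ = Γ⊆Δ , i , i∈Δ , λ i∈Γ → F∉Γ (∈⟦⟧⁺ i∈Γ F≡)

  ⟦∪⟧⊆ : ⟦ Γ ∪ Δ ⟧ ⊆ ⟦ Γ ⟧ ++ ⟦ Δ ⟧
  ⟦∪⟧⊆ {Γ} {Δ} F∈ with ∈⟦⟧⁻ F∈
  ... | i , i∈ , F≡ with x∈p∪q⁻ Γ Δ i∈
  ...   | inj₁ i∈Γ = ∈-++⁺ˡ (∈⟦⟧⁺ i∈Γ F≡)
  ...   | inj₂ i∈Δ = ∈-++⁺ʳ ⟦ Γ ⟧ (∈⟦⟧⁺ i∈Δ F≡)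

  select : {P : Pred Formula 0ℓ} → Decidable P → Ctx
  select P? = tabulate (isYes ∘ P? ∘ lookup S)

  module _ {P : Pred Formula 0ℓ} (P? : Decidable P) where

    ∈-select⁺ : P (lookup S i) → i ∈ˢ select P?
    ∈-select⁺ {i} p = lookup⇒[]= i (select P?)
      (trans (lookup∘tabulate (isYes ∘ P? ∘ lookup S) i) (Equivalence.to T-≡ (fromWitness p)))

    ∈-select⁻ : i ∈ˢ select P? → P (lookup S i)
    ∈-select⁻ {i} i∈ = toWitness (Equivalence.from T-≡
      (trans (sym (lookup∘tabulate (isYes ∘ P? ∘ lookup S) i)) ([]=⇒lookup i∈)))

    ⟦select⟧⊆filter : ⟦ select P? ⟧ ⊆ filter P? S
    ⟦select⟧⊆filter F∈ with ∈⟦⟧⁻ F∈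
    ... | i , i∈ , refl = ∈-filter⁺ P? (∈-lookup {xs = S} i) (∈-select⁻ i∈)

    ∈⟦select⟧ : F ∈ S → P F → F ∈ ⟦ select P? ⟧
    ∈⟦select⟧ {F} F∈S p = ∈⟦⟧⁺ (∈-select⁺ (subst P F≡ p)) F≡
      where
        F≡ : F ≡ lookup S (index F∈S)
        F≡ = lookup-index F∈S

  infixl 5 _▹_
  _▹_ : Ctx → Formula → Ctx
  Γ ▹ F = Γ ∪ select (_≟ F)

  ⊆-▹ : Γ ⊆ˢ Γ ▹ F
  ⊆-▹ = p⊆p∪q _

  ∈-▹ : F ∈ S → F ∈ ⟦ Γ ▹ F ⟧
  ∈-▹ {F} {Γ} F∈S = ⟦⟧-mono (q⊆p∪q Γ _) (∈⟦select⟧ (_≟ F) F∈S refl)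

  ⟦▹⟧⊆ : ⟦ Γ ▹ F ⟧ ⊆ F ∷ ⟦ Γ ⟧
  ⟦▹⟧⊆ {Γ} {F} G∈ with ∈-++⁻ ⟦ Γ ⟧ (⟦∪⟧⊆ G∈)
  ... | inj₁ G∈Γ = there G∈Γ
  ... | inj₂ G∈F with ∈-filter⁻ (_≟ F) {xs = S} (⟦select⟧⊆filter (_≟ F) G∈F)
  ...   | _ , refl = here refl

  ⊂-▹ : F ∈ S → F ∉ ⟦ Γ ⟧ → Γ ⊂ Γ ▹ F
  ⊂-▹ F∈S = ⊆-new⇒⊂ ⊆-▹ (∈-▹ F∈S)

  boxed? : ∀ Γ → Decidable (λ A → □ A ∈ ⟦ Γ ⟧)
  boxed? Γ A = □ A ∈? ⟦ Γ ⟧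

  □⁻¹ : Ctx → List Formula
  □⁻¹ Γ = filter (boxed? Γ) S

  unbox : Ctx → Ctx
  unbox Γ = Γ ∪ select (boxed? Γ)

  ⊆-unbox : Γ ⊆ˢ unbox Γ
  ⊆-unbox = p⊆p∪q _

  ∈-unbox : A ∈ S → □ A ∈ ⟦ Γ ⟧ → A ∈ ⟦ unbox Γ ⟧
  ∈-unbox {Γ = Γ} A∈S □A∈Γ = ⟦⟧-mono (q⊆p∪q Γ _) (∈⟦select⟧ (boxed? Γ) A∈S □A∈Γ)

  ⟦unbox⟧⊆ : ⟦ unbox Γ ⟧ ⊆ □⁻¹ Γ ++ ⟦ Γ ⟧
  ⟦unbox⟧⊆ {Γ} A∈ with ∈-++⁻ ⟦ Γ ⟧ (⟦∪⟧⊆ A∈)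
  ... | inj₁ A∈Γ = ∈-++⁺ʳ (□⁻¹ Γ) A∈Γ
  ... | inj₂ A∈  = ∈-++⁺ˡ (⟦select⟧⊆filter (boxed? Γ) A∈)

  □⁻¹-boxed : A ∈ □⁻¹ Γ → □ A ∈ ⟦ Γ ⟧
  □⁻¹-boxed {Γ = Γ} = proj₂ ∘ ∈-filter⁻ (boxed? Γ) {xs = S}

module Calculus (S : List Formula) (closed : SubformulaClosed S) where

  open FiniteContexts S

  private
    variable
      Γ : Ctx

  Sequent : Set
  Sequent = Ctx × Formula

  Right : Pred Sequent 0ℓ → Ctx → Formula → Set
  Right P Γ (A ∧ B) = P (Γ , A) × P (Γ , B)
  Right P Γ (A ∨ B) = P (Γ , A) ⊎ P (Γ , B)
  Right P Γ (A ⇒ B) = P (Γ ▹ A , B)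
  Right P Γ (□ B)   = P (unbox Γ , B)
  Right P Γ _       = ⊥

  Left : Pred Sequent 0ℓ → Ctx → Formula → Formula → Set
  Left P Γ C ⊥'      = ⊤
  Left P Γ C (A ∧ B) = P (Γ ▹ A , C) ⊎ P (Γ ▹ B , C)
  Left P Γ C (A ∨ B) = P (Γ ▹ A , C) × P (Γ ▹ B , C)
  Left P Γ C (A ⇒ B) = P (Γ , A) × P (Γ ▹ B , C)
  Left P Γ C _       = ⊥

  -- Contexts are sets, so a left rule keeps its principal formula: contraction is built in.
  Rules : Pred Sequent 0ℓ → Pred Sequent 0ℓ
  Rules P (Γ , C) = C ∈ ⟦ Γ ⟧ ⊎ Right P Γ C ⊎ Any (Left P Γ C) ⟦ Γ ⟧

  module _ {P : Pred Sequent 0ℓ} (P? : Decidable P) where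

    right? : ∀ Γ C → Dec (Right P Γ C)
    right? Γ (atom _) = no λ ()
    right? Γ ⊥'       = no λ ()
    right? Γ (A ∧ B)  = P? (Γ , A) ×-dec P? (Γ , B)
    right? Γ (A ∨ B)  = P? (Γ , A) ⊎-dec P? (Γ , B)
    right? Γ (A ⇒ B)  = P? (Γ ▹ A , B)
    right? Γ (□ B)    = P? (unbox Γ , B)

    left? : ∀ Γ C G → Dec (Left P Γ C G)
    left? Γ C (atom _) = no λ ()
    left? Γ C ⊥'       = yes tt
    left? Γ C (A ∧ B)  = P? (Γ ▹ A , C) ⊎-dec P? (Γ ▹ B , C)
    left? Γ C (A ∨ B)  = P? (Γ ▹ A , C) ×-dec P? (Γ ▹ B , C)
    left? Γ C (A ⇒ B)  = P? (Γ , A) ×-dec P? (Γ ▹ B , C)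
    left? Γ C (□ _)    = no λ ()

    rules? : Decidable (Rules P)
    rules? (Γ , C) = C ∈? ⟦ Γ ⟧ ⊎-dec right? Γ C ⊎-dec any? (left? Γ C) ⟦ Γ ⟧

  module _ {P Q : Pred Sequent 0ℓ} (P⊆Q : ∀ {Γ C} → C ∈ S → P (Γ , C) → Q (Γ , C)) where

    right-mono : C ∈ S → Right P Γ C → Right Q Γ C
    right-mono {A ∧ B} C∈S = Product.map (P⊆Q (closed ∧◁ˡ C∈S)) (P⊆Q (closed ∧◁ʳ C∈S))
    right-mono {A ∨ B} C∈S = Sum.map (P⊆Q (closed ∨◁ˡ C∈S)) (P⊆Q (closed ∨◁ʳ C∈S))
    right-mono {A ⇒ B} C∈S = P⊆Q (closed ⇒◁ʳ C∈S)
    right-mono {□ B}   C∈S = P⊆Q (closed □◁ C∈S)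

    left-mono : C ∈ S → G ∈ S → Left P Γ C G → Left Q Γ C G
    left-mono {G = ⊥'}    C∈S G∈S = id
    left-mono {G = A ∧ B} C∈S G∈S = Sum.map (P⊆Q C∈S) (P⊆Q C∈S)
    left-mono {G = A ∨ B} C∈S G∈S = Product.map (P⊆Q C∈S) (P⊆Q C∈S)
    left-mono {G = A ⇒ B} C∈S G∈S = Product.map (P⊆Q (closed ⇒◁ˡ G∈S)) (P⊆Q C∈S)

    rules-mono : C ∈ S → Rules P (Γ , C) → Rules Q (Γ , C)
    rules-mono {C} {Γ} C∈S = Sum.map₂ (Sum.map (right-mono C∈S) left-mono-any)
      where
        left-mono-any : Any (Left P Γ C) ⟦ Γ ⟧ → Any (Left Q Γ C) ⟦ Γ ⟧
        left-mono-any l with find l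
        ... | G , G∈Γ , lG = lose G∈Γ (left-mono C∈S (⟦⟧⊆S G∈Γ) lG)

  Sequents : List Sequent
  Sequents = cartesianProduct (subsets (length S)) S

  ∈-Sequents : C ∈ S → (Γ , C) ∈ Sequents
  ∈-Sequents {Γ = Γ} = ∈-cartesianProduct⁺ (∈-subsets Γ)

  ∈-Sequents⁻ : (Γ , C) ∈ Sequents → C ∈ S
  ∈-Sequents⁻ = proj₂ ∘ ∈-cartesianProduct⁻ (subsets (length S)) S

  Rules-mono : ∀ {P Q} → (∀ {s} → s ∈ Sequents → P s → Q s) →
               ∀ {s} → s ∈ Sequents → Rules P s → Rules Q s
  Rules-mono P⊆Q {_ , _} = rules-mono (P⊆Q ∘ ∈-Sequents) ∘ ∈-Sequents⁻

  open LeastFixedPoint Sequents Rules Rules-mono rules?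

  infix 4 _⊢ˢ_ _⊢ˢ?_
  _⊢ˢ_ : Ctx → Formula → Set
  Γ ⊢ˢ C = μ (Γ , C)

  _⊢ˢ?_ : ∀ Γ C → Dec (Γ ⊢ˢ C)
  Γ ⊢ˢ? C = μ? (Γ , C)

  ⊢ˢ-init : C ∈ ⟦ Γ ⟧ → Γ ⊢ˢ C
  ⊢ˢ-init C∈Γ = μ-closed (∈-Sequents (⟦⟧⊆S C∈Γ)) (inj₁ C∈Γ)

  ⊢ˢ-right : C ∈ S → Right μ Γ C → Γ ⊢ˢ C
  ⊢ˢ-right C∈S = μ-closed (∈-Sequents C∈S) ∘ inj₂ ∘ inj₁

  ⊢ˢ-left : C ∈ S → G ∈ ⟦ Γ ⟧ → Left μ Γ C G → Γ ⊢ˢ C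
  ⊢ˢ-left C∈S G∈Γ = μ-closed (∈-Sequents C∈S) ∘ inj₂ ∘ inj₂ ∘ lose G∈Γ

  Derivable : Pred Sequent 0ℓ
  Derivable (Γ , C) = ⟦ Γ ⟧ ⊢ C

  right-sound : Right Derivable Γ C → ⟦ Γ ⟧ ⊢ C
  right-sound {C = A ∧ B} (a , b) = ∧I a b
  right-sound {C = A ∨ B} (inj₁ a) = ∨I₁ a
  right-sound {C = A ∨ B} (inj₂ b) = ∨I₂ b
  right-sound {C = A ⇒ B} b = ⇒I (weaken ⟦▹⟧⊆ b)
  right-sound {Γ} {C = □ B} b = □I (□⁻¹ Γ) (All.tabulate (ax ∘ □⁻¹-boxed)) (weaken ⟦unbox⟧⊆ b)

  left-sound : G ∈ ⟦ Γ ⟧ → Left Derivable Γ C G → ⟦ Γ ⟧ ⊢ C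
  left-sound {G = ⊥'}    G∈Γ _        = ⊥E (ax G∈Γ)
  left-sound {G = A ∧ B} G∈Γ (inj₁ c) = cut (∧E₁ (ax G∈Γ)) (weaken ⟦▹⟧⊆ c)
  left-sound {G = A ∧ B} G∈Γ (inj₂ c) = cut (∧E₂ (ax G∈Γ)) (weaken ⟦▹⟧⊆ c)
  left-sound {G = A ∨ B} G∈Γ (c , c′) = ∨E (ax G∈Γ) (weaken ⟦▹⟧⊆ c) (weaken ⟦▹⟧⊆ c′)
  left-sound {G = A ⇒ B} G∈Γ (a , c)  = cut (⇒E (ax G∈Γ) a) (weaken ⟦▹⟧⊆ c)

  rules-sound : ∀ {s} → Rules Derivable s → Derivable s
  rules-sound (inj₁ C∈Γ)      = ax C∈Γ
  rules-sound (inj₂ (inj₁ r)) = right-sound r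
  rules-sound (inj₂ (inj₂ l)) with find l
  ... | G , G∈Γ , lG = left-sound G∈Γ lG

  ⊢ˢ-sound : C ∈ S → Γ ⊢ˢ C → ⟦ Γ ⟧ ⊢ C
  ⊢ˢ-sound C∈S = μ-least (const rules-sound) (∈-Sequents C∈S)

  Expanded : Ctx → Formula → Set
  Expanded Γ ⊥'      = ⊥
  Expanded Γ (A ∧ B) = A ∈ ⟦ Γ ⟧ × B ∈ ⟦ Γ ⟧
  Expanded Γ (A ∨ B) = A ∈ ⟦ Γ ⟧ ⊎ B ∈ ⟦ Γ ⟧
  Expanded Γ (A ⇒ B) = Γ ⊢ˢ A → B ∈ ⟦ Γ ⟧
  Expanded Γ _       = ⊤

  expanded? : ∀ Γ G → Dec (Expanded Γ G)
  expanded? Γ (atom _) = yes tt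
  expanded? Γ ⊥'       = no id
  expanded? Γ (A ∧ B)  = A ∈? ⟦ Γ ⟧ ×-dec B ∈? ⟦ Γ ⟧
  expanded? Γ (A ∨ B)  = A ∈? ⟦ Γ ⟧ ⊎-dec B ∈? ⟦ Γ ⟧
  expanded? Γ (A ⇒ B)  = Γ ⊢ˢ? A →-dec B ∈? ⟦ Γ ⟧
  expanded? Γ (□ _)    = yes tt

  Saturated : Ctx → Set
  Saturated Γ = All (Expanded Γ) ⟦ Γ ⟧

  extend-by : F ◁ G → G ∈ ⟦ Γ ⟧ → F ∉ ⟦ Γ ⟧ → ¬ Γ ▹ F ⊢ˢ C → ∃[ Δ ] Γ ⊂ Δ × ¬ Δ ⊢ˢ C
  extend-by {F = F} {Γ = Γ} F◁G G∈Γ F∉Γ ⊬C = Γ ▹ F , ⊂-▹ (closed F◁G (⟦⟧⊆S G∈Γ)) F∉Γ , ⊬C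

  extend-unexpanded : C ∈ S → ¬ Γ ⊢ˢ C → G ∈ ⟦ Γ ⟧ → ¬ Expanded Γ G → ∃[ Δ ] Γ ⊂ Δ × ¬ Δ ⊢ˢ C
  extend-unexpanded {G = atom _} C∈S ⊬C G∈Γ ¬e = ⊥-elim (¬e tt)
  extend-unexpanded {G = ⊥'}     C∈S ⊬C G∈Γ ¬e = ⊥-elim (⊬C (⊢ˢ-left C∈S G∈Γ tt))
  extend-unexpanded {G = □ _}    C∈S ⊬C G∈Γ ¬e = ⊥-elim (¬e tt)
  extend-unexpanded {Γ = Γ} {G = A ∧ B} C∈S ⊬C G∈Γ ¬e with A ∈? ⟦ Γ ⟧
  ... | no A∉Γ  = extend-by ∧◁ˡ G∈Γ A∉Γ (⊬C ∘ ⊢ˢ-left C∈S G∈Γ ∘ inj₁)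
  ... | yes A∈Γ = extend-by ∧◁ʳ G∈Γ (¬e ∘ (A∈Γ ,_)) (⊬C ∘ ⊢ˢ-left C∈S G∈Γ ∘ inj₂)
  extend-unexpanded {C = C} {Γ = Γ} {G = A ∨ B} C∈S ⊬C G∈Γ ¬e with Γ ▹ A ⊢ˢ? C
  ... | no ⊬A  = extend-by ∨◁ˡ G∈Γ (¬e ∘ inj₁) ⊬A
  ... | yes ⊢A = extend-by ∨◁ʳ G∈Γ (¬e ∘ inj₂) (⊬C ∘ ⊢ˢ-left C∈S G∈Γ ∘ (⊢A ,_))
  extend-unexpanded {Γ = Γ} {G = A ⇒ B} C∈S ⊬C G∈Γ ¬e with Γ ⊢ˢ? A | B ∈? ⟦ Γ ⟧
  ... | no ⊬A  | _      = ⊥-elim (¬e (⊥-elim ∘ ⊬A))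
  ... | yes _  | yes B∈Γ = ⊥-elim (¬e (const B∈Γ))
  ... | yes ⊢A | no B∉Γ  = extend-by ⇒◁ʳ G∈Γ B∉Γ (⊬C ∘ ⊢ˢ-left C∈S G∈Γ ∘ (⊢A ,_))

  record World : Set where
    field
      ctx       : Ctx
      saturated : Saturated ctx

  open World

  saturate : C ∈ S → Acc _⊃_ Γ → ¬ Γ ⊢ˢ C → ∃[ w ] Γ ⊆ˢ ctx w × ¬ ctx w ⊢ˢ C
  saturate {Γ = Γ} C∈S (acc larger) ⊬C with all? (expanded? Γ) ⟦ Γ ⟧
  ... | yes sat = record { ctx = Γ ; saturated = sat } , ⊆ˢ-refl , ⊬C
  ... | no ¬sat with find (¬All⇒Any¬ (expanded? Γ) ⟦ Γ ⟧ ¬sat)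
  ...   | G , G∈Γ , ¬e with extend-unexpanded C∈S ⊬C G∈Γ ¬e
  ...     | Δ , Γ⊂Δ , ⊬ΔC with saturate C∈S (larger Γ⊂Δ) ⊬ΔC
  ...       | w , Δ⊆w , ⊬wC = w , ⊆ˢ-trans (p⊂q⇒p⊆q Γ⊂Δ) Δ⊆w , ⊬wC

  canonical : Model
  canonical = record
    { W       = World
    ; _≼_     = λ w v → ⟦ ctx w ⟧ ⊆ ⟦ ctx v ⟧
    ; E       = λ w v → ⟦ ctx w ⟧ ⊆ ⟦ ctx v ⟧ × (∀ {A} → □ A ∈ ⟦ ctx w ⟧ → A ∈ ⟦ ctx v ⟧)
    ; V       = λ w p → atom p ∈ ⟦ ctx w ⟧
    ; ≼-refl  = id
    ; ≼-trans = λ w≼v v≼u → v≼u ∘ w≼v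
    ; E⇒≼    = proj₁
    ; ≼-E    = λ w≼v (v≼u , unbox-vu) → v≼u ∘ w≼v , unbox-vu ∘ w≼v
    ; V-mono = λ w≼v → w≼v
    }

  open Forcing canonical

  ⊩-above⇒⊢ˢ : C ∈ S → (∀ {w} → w ⊩ C → ctx w ⊢ˢ C) →
               (∀ w → ⟦ Γ ⟧ ⊆ ⟦ ctx w ⟧ → w ⊩ C) → Γ ⊢ˢ C
  ⊩-above⇒⊢ˢ {C = C} {Γ = Γ} C∈S truth forced with Γ ⊢ˢ? C
  ... | yes ⊢C = ⊢C
  ... | no ⊬C with saturate C∈S (⊃-wellFounded Γ) ⊬C
  ...   | w , Γ⊆w , ⊬wC = ⊥-elim (⊬wC (truth (forced w (⟦⟧-mono Γ⊆w))))

  mutual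
    ∈⇒⊩ : ∀ {w} → F ∈ S → F ∈ ⟦ ctx w ⟧ → w ⊩ F
    ∈⇒⊩ {atom p}      F∈S F∈w = F∈w
    ∈⇒⊩ {⊥'}    {w}   F∈S F∈w = All.lookup (saturated w) F∈w
    ∈⇒⊩ {A ∧ B} {w}   F∈S F∈w with All.lookup (saturated w) F∈w
    ... | A∈w , B∈w = ∈⇒⊩ (closed ∧◁ˡ F∈S) A∈w , ∈⇒⊩ (closed ∧◁ʳ F∈S) B∈w
    ∈⇒⊩ {A ∨ B} {w}   F∈S F∈w with All.lookup (saturated w) F∈w
    ... | inj₁ A∈w = inj₁ (∈⇒⊩ (closed ∨◁ˡ F∈S) A∈w)
    ... | inj₂ B∈w = inj₂ (∈⇒⊩ (closed ∨◁ʳ F∈S) B∈w)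
    ∈⇒⊩ {A ⇒ B}       F∈S F∈w v w≼v v⊩A =
      ∈⇒⊩ (closed ⇒◁ʳ F∈S)
        (All.lookup (saturated v) (w≼v F∈w) (⊩⇒⊢ˢ (closed ⇒◁ˡ F∈S) v⊩A))
    ∈⇒⊩ {□ A}         F∈S F∈w v (_ , unbox-wv) = ∈⇒⊩ (closed □◁ F∈S) (unbox-wv F∈w)

    ⊩⇒⊢ˢ : ∀ {w} → F ∈ S → w ⊩ F → ctx w ⊢ˢ F
    ⊩⇒⊢ˢ {atom p} F∈S w⊩F = ⊢ˢ-init w⊩F
    ⊩⇒⊢ˢ {A ∧ B} F∈S (a , b) =
      ⊢ˢ-right F∈S (⊩⇒⊢ˢ (closed ∧◁ˡ F∈S) a , ⊩⇒⊢ˢ (closed ∧◁ʳ F∈S) b)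
    ⊩⇒⊢ˢ {A ∨ B} F∈S (inj₁ a) = ⊢ˢ-right F∈S (inj₁ (⊩⇒⊢ˢ (closed ∨◁ˡ F∈S) a))
    ⊩⇒⊢ˢ {A ∨ B} F∈S (inj₂ b) = ⊢ˢ-right F∈S (inj₂ (⊩⇒⊢ˢ (closed ∨◁ʳ F∈S) b))
    ⊩⇒⊢ˢ {A ⇒ B} F∈S w⊩F = ⊢ˢ-right F∈S
      (⊩-above⇒⊢ˢ B∈S (⊩⇒⊢ˢ B∈S) λ v w▹A≼v →
        w⊩F v (w▹A≼v ∘ ⟦⟧-mono ⊆-▹) (∈⇒⊩ A∈S (w▹A≼v (∈-▹ A∈S))))
      where
        A∈S : A ∈ S
        A∈S = closed ⇒◁ˡ F∈S
        B∈S : B ∈ S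
        B∈S = closed ⇒◁ʳ F∈S
    ⊩⇒⊢ˢ {□ A} F∈S w⊩F = ⊢ˢ-right F∈S
      (⊩-above⇒⊢ˢ A∈S (⊩⇒⊢ˢ A∈S) λ v unbox-w≼v →
        w⊩F v ( unbox-w≼v ∘ ⟦⟧-mono ⊆-unbox
              , λ □B∈w → unbox-w≼v (∈-unbox (closed □◁ (⟦⟧⊆S □B∈w)) □B∈w)))
      where
        A∈S : A ∈ S
        A∈S = closed □◁ F∈S

  ⊢ˢ-complete : C ∈ S → ⟦ Γ ⟧ ⊢ C → Γ ⊢ˢ C
  ⊢ˢ-complete C∈S ⊢C = ⊩-above⇒⊢ˢ C∈S (⊩⇒⊢ˢ C∈S) λ w Γ⊆w →
    ⊩-sound ⊢C (All.tabulate λ A∈Γ → ∈⇒⊩ (⟦⟧⊆S A∈Γ) (Γ⊆w A∈Γ))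

corollary28 : (A : Formula) → Dec (IEL⁻⊢ A)
corollary28 A =
  map′ (weaken ⟦∅⟧⊆[] ∘ ⊢ˢ-sound A∈S) (⊢ˢ-complete A∈S ∘ weaken λ ()) (∅ ⊢ˢ? A)
  where
    open FiniteContexts (subformulas A)
    open Calculus (subformulas A) (subformulas-closed A)
    A∈S : A ∈ subformulas A
    A∈S = here refl
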